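{- If $G$ is a minimal $DD_2$-graph, then $\gamma\gamma_2(G)=|V_G|$.
   Context: All graphs are finite and simple. A set $D\subseteq V_G$ is dominating if every vertex of $V_G-D$ has a neighbor in $D$; it is 2-dominating if every vertex of $V_G-D$ has at least two neighbors in $D$. A $DD_2$-pair is a pair $(D,D_2)$ of disjoint vertex sets with $D$ dominating and $D_2$ 2-dominating; $G$ is a $DD_2$-graph if it has one. A connected graph is a minimal $DD_2$-graph if it is a $DD_2$-graph and no proper spanning subgraph of it is a $DD_2$-graph; a disconnected graph is a minimal $DD_2$-graph if every connected component is a minimal $DD_2$-graph. For a $DD_2$-graph $G$, $\gamma\gamma_2(G)=\min\{|D|+|D_2| : (D,D_2)\text{ is a }DD_2\text{ -pair in }G\}$. -}

module Defs where

open import Data.Nat using (ℕ; _+_; _≤_)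
open import Data.Bool using (Bool; true; false)
open import Data.Fin using (Fin)
open import Data.Fin.Subset using (Subset; _∈_; _∉_; _⊆_; ∣_∣)
open import Data.Product using (Σ; ∃; ∃-syntax; _×_)
open import Relation.Binary.PropositionalEquality using (_≡_; _≢_)

record Graph (n : ℕ) : Set where
  field
    adj    : Fin n → Fin n → Bool
    sym    : ∀ u v → adj u v ≡ adj v u
    irrefl : ∀ v → adj v v ≡ false
open Graph public

Adj : ∀ {n} → Graph n → Fin n → Fin n → Set
Adj G u v = adj G u v ≡ true

Dominating : ∀ {n} → Graph n → Subset n → Subset n → Set
Dominating {n} G S D = ∀ (v : Fin n) → v ∈ S → v ∉ D → ∃[ u ] (u ∈ D × Adj G u v)

TwoDominating : ∀ {n} → Graph n → Subset n → Subset n → Set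
TwoDominating {n} G S D = ∀ (v : Fin n) → v ∈ S → v ∉ D →
  ∃[ u ] ∃[ w ] (u ≢ w × u ∈ D × w ∈ D × Adj G u v × Adj G w v)

record DD2PairOn {n} (G : Graph n) (S : Subset n) (D D₂ : Subset n) : Set where
  field
    D⊆S      : D ⊆ S
    D₂⊆S     : D₂ ⊆ S
    disjoint : ∀ v → v ∈ D → v ∉ D₂
    dom      : Dominating G S D
    dom₂     : TwoDominating G S D₂

IsDD2GraphOn : ∀ {n} → Graph n → Subset n → Set
IsDD2GraphOn G S = ∃[ D ] ∃[ D₂ ] DD2PairOn G S D D₂

Full : ∀ n → Subset n
Full n = Data.Fin.Subset.⊤

DD2Pair : ∀ {n} → Graph n → Subset n → Subset n → Set
DD2Pair {n} G D D₂ = DD2PairOn G (Full n) D D₂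

data ReachIn {n} (G : Graph n) (S : Subset n) : Fin n → Fin n → Set where
  here  : ∀ {v} → v ∈ S → ReachIn G S v v
  step  : ∀ {u v w} → u ∈ S → Adj G u v → ReachIn G S v w → ReachIn G S u w

record IsComponent {n} (G : Graph n) (S : Subset n) : Set where
  field
    nonempty  : ∃[ v ] (v ∈ S)
    connected : ∀ u v → u ∈ S → v ∈ S → ReachIn G S u v
    closed    : ∀ u v → u ∈ S → Adj G u v → v ∈ S

-- H is a proper spanning subgraph of the induced subgraph G[S]: all edges of H
-- inside S are edges of G, and some edge of G inside S is missing from H.
-- (Edges of H outside S are irrelevant, since only H[S] is considered.)
record ProperSpanningSubgraphOn {n} (G H : Graph n) (S : Subset n) : Set where
  field
    sub     : ∀ u v → u ∈ S → v ∈ S → Adj H u v → Adj G u v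
    missing : ∃[ u ] ∃[ v ] (u ∈ S × v ∈ S × Adj G u v × adj H u v ≡ false)

MinimalDD2On : ∀ {n} → Graph n → Subset n → Set
MinimalDD2On {n} G S =
  IsDD2GraphOn G S ×
  (∀ (H : Graph n) → ProperSpanningSubgraphOn G H S → IsDD2GraphOn H S → Data.Empty.⊥)
  where import Data.Empty

MinimalDD2Graph : ∀ {n} → Graph n → Set
MinimalDD2Graph G = ∀ S → IsComponent G S → MinimalDD2On G S

GammaGamma2 : ∀ {n} → Graph n → ℕ → Set
GammaGamma2 G k =
  (∃[ D ] ∃[ D₂ ] (DD2Pair G D D₂ × ∣ D ∣ + ∣ D₂ ∣ ≡ k)) ×
  (∀ D D₂ → DD2Pair G D D₂ → k ≤ ∣ D ∣ + ∣ D₂ ∣)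

-- Lower bound: if some vertex v lies in neither D nor D₂ of a DD₂-pair, it is
-- dominated by some u ∈ D. Deleting the edge uv and moving v into D still gives a
-- DD₂-pair of the component of v: v now dominates itself, and no 2-dominating
-- neighbour is lost because u ∉ D₂ and v ∉ D₂. This contradicts minimality, so
-- D ∪ D₂ = V and |D| + |D₂| ≥ |V|.
-- Upper bound: the DD₂-pairs of the components glue to a DD₂-pair (D, D₂) of G,
-- and (V ∖ D₂, D₂) is then a DD₂-pair of size exactly |V|.
module Submission where

open import Defs
open import Data.Nat using (ℕ; zero; suc; _+_; _≤_; s≤s)
open import Data.Nat.Properties using (≤-trans; ≤-reflexive; +-monoʳ-≤; n≮n; m+[n∸m]≡n; m∸n+n≡m)
open import Data.Bool using (Bool; true; false; _∧_; not)
open import Data.Bool.Properties using (∧-conicalˡ; ∧-zeroʳ) renaming (_≟_ to _≟ᴮ_)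
open import Data.Fin using (Fin)
open import Data.Fin.Properties using (any?; _≟_)
open import Data.Fin.Subset using (Subset; _∈_; _∉_; _⊆_; _⊂_; ∣_∣; ⁅_⁆; _∪_; _∩_; ∁; ⊥)
open import Data.Fin.Subset.Properties
open import Data.Vec using (tabulate; lookup)
open import Data.Vec.Properties using ([]=⇒lookup; lookup⇒[]=; lookup∘tabulate)
open import Data.Product using (∃-syntax; _×_; _,_; proj₁; proj₂; uncurry)
open import Data.Sum using (_⊎_; inj₁; inj₂; [_,_])
open import Data.Empty using (⊥-elim)
open import Function using (_∘_)
open import Function.Bundles using (_⇔_; mk⇔)
open import Relation.Nullary using (¬_; Dec; yes; no; does; contradiction)
open import Relation.Nullary.Decidable using (_×-dec_; _⊎-dec_; dec-true; dec-false; does-⇔)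
open import Relation.Binary.PropositionalEquality
  using (_≡_; _≢_; refl; trans; cong; subst) renaming (sym to ≡-sym)

module _ {n : ℕ} where

  ∈tabulate⁺ : ∀ (f : Fin n → Bool) {y} → f y ≡ true → y ∈ tabulate f
  ∈tabulate⁺ f {y} fy = lookup⇒[]= y (tabulate f) (trans (lookup∘tabulate f y) fy)

  ∈tabulate⁻ : ∀ (f : Fin n → Bool) {y} → y ∈ tabulate f → f y ≡ true
  ∈tabulate⁻ f {y} y∈ = trans (≡-sym (lookup∘tabulate f y)) ([]=⇒lookup y∈)

  diagonal : (Fin n → Subset n) → Subset n
  diagonal F = tabulate (λ y → lookup (F y) y)

  ∈diagonal⁺ : ∀ F {y} → y ∈ F y → y ∈ diagonal F
  ∈diagonal⁺ F y∈ = ∈tabulate⁺ _ ([]=⇒lookup y∈)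

  ∈diagonal⁻ : ∀ F {y} → y ∈ diagonal F → y ∈ F y
  ∈diagonal⁻ F {y} y∈ = lookup⇒[]= y _ (∈tabulate⁻ _ y∈)

  ⊆∧¬⊂⇒⊇ : ∀ {p q : Subset n} → p ⊆ q → ¬ p ⊂ q → q ⊆ p
  ⊆∧¬⊂⇒⊇ {p} p⊆q p⊄q {z} z∈q with z ∈? p
  ... | yes z∈p = z∈p
  ... | no z∉p = contradiction ((λ {x} → p⊆q {x}) , z , z∈q , z∉p) p⊄q

  ∁⊆⇒n≤∣p∣+∣q∣ : ∀ {p q : Subset n} → ∁ p ⊆ q → n ≤ ∣ p ∣ + ∣ q ∣
  ∁⊆⇒n≤∣p∣+∣q∣ {p} {q} ∁p⊆q = subst (_≤ ∣ p ∣ + ∣ q ∣) (m+[n∸m]≡n (∣p∣≤n p))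
    (+-monoʳ-≤ ∣ p ∣ (subst (_≤ ∣ q ∣) (∣∁p∣≡n∸∣p∣ p) (p⊆q⇒∣p∣≤∣q∣ ∁p⊆q)))

  ∣∁p∣+∣p∣≡n : ∀ (p : Subset n) → ∣ ∁ p ∣ + ∣ p ∣ ≡ n
  ∣∁p∣+∣p∣≡n p = trans (cong (_+ ∣ p ∣) (∣∁p∣≡n∸∣p∣ p)) (m∸n+n≡m (∣p∣≤n p))

Closed : ∀ {n} → Graph n → Subset n → Set
Closed {n} G T = ∀ (u v : Fin n) → u ∈ T → Adj G u v → v ∈ T

module _ {n : ℕ} (G : Graph n) where

  Adj-sym : ∀ {a b} → Adj G a b → Adj G b a
  Adj-sym {a} {b} e = trans (sym G b a) e

  reach-source : ∀ {S a b} → ReachIn G S a b → a ∈ S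
  reach-source (here a∈) = a∈
  reach-source (step a∈ _ _) = a∈

  reach-trans : ∀ {S a b c} → ReachIn G S a b → ReachIn G S b c → ReachIn G S a c
  reach-trans (here _) q = q
  reach-trans (step a∈ e p) q = step a∈ e (reach-trans p q)

  reach-sym : ∀ {S a b} → ReachIn G S a b → ReachIn G S b a
  reach-sym (here a∈) = here a∈
  reach-sym (step a∈ e p) = reach-trans (reach-sym p) (step (reach-source p) (Adj-sym e) (here a∈))

  reach-closed : ∀ {S T a b} → Closed G T → a ∈ T → ReachIn G S a b → b ∈ T
  reach-closed closed a∈ (here _) = a∈
  reach-closed closed a∈ (step _ e p) = reach-closed closed (closed _ _ a∈ e) p

  component-⊆ : ∀ {S T w} → IsComponent G S → IsComponent G T → w ∈ S → w ∈ T → S ⊆ T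
  component-⊆ {w = w} cS cT w∈S w∈T {z} z∈S =
    reach-closed (IsComponent.closed cT) w∈T (IsComponent.connected cS w z w∈S z∈S)

  component-unique : ∀ {S T w} → IsComponent G S → IsComponent G T → w ∈ S → w ∈ T → S ≡ T
  component-unique cS cT w∈S w∈T = ⊆-antisym (component-⊆ cS cT w∈S w∈T) (component-⊆ cT cS w∈T w∈S)

  neighbourIn? : ∀ (R : Subset n) y → Dec (∃[ x ] (x ∈ R × Adj G x y))
  neighbourIn? R y = any? (λ x → x ∈? R ×-dec adj G x y ≟ᴮ true)

  neighbours : Subset n → Subset n
  neighbours R = tabulate (does ∘ neighbourIn? R)

  ∈neighbours⁺ : ∀ {R x y} → x ∈ R → Adj G x y → y ∈ neighbours R
  ∈neighbours⁺ {R} {y = y} x∈ e = ∈tabulate⁺ (does ∘ neighbourIn? R) (dec-true (neighbourIn? R y) (_ , x∈ , e))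

  ∈neighbours⁻ : ∀ {R y} → y ∈ neighbours R → ∃[ x ] (x ∈ R × Adj G x y)
  ∈neighbours⁻ {R} {y} y∈ with neighbourIn? R y | ∈tabulate⁻ (does ∘ neighbourIn? R) y∈
  ... | yes witness | _ = witness

  expand : Subset n → Subset n
  expand R = R ∪ neighbours R

  expand-mono : ∀ {R R′} → R ⊆ R′ → expand R ⊆ expand R′
  expand-mono {R} R⊆R′ z∈ with x∈p∪q⁻ R (neighbours R) z∈
  ... | inj₁ z∈R = x∈p∪q⁺ (inj₁ (R⊆R′ z∈R))
  ... | inj₂ z∈N with ∈neighbours⁻ z∈N
  ... | _ , x∈R , e = x∈p∪q⁺ (inj₂ (∈neighbours⁺ (R⊆R′ x∈R) e))

  ball : Fin n → ℕ → Subset n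
  ball x zero = ⁅ x ⁆
  ball x (suc k) = expand (ball x k)

  -- Each strict expansion adds a vertex, so after n steps the ball is a fixed point.
  ball-fixed-or-grows : ∀ x k → expand (ball x k) ⊆ ball x k ⊎ suc k ≤ ∣ ball x k ∣
  ball-fixed-or-grows x zero = inj₂ (≤-reflexive (≡-sym (∣⁅x⁆∣≡1 x)))
  ball-fixed-or-grows x (suc k) with ball-fixed-or-grows x k
  ... | inj₁ fixed = inj₁ (expand-mono fixed)
  ... | inj₂ large with ball x k ⊂? ball x (suc k)
  ...   | yes grows = inj₂ (≤-trans (s≤s large) (p⊂q⇒∣p∣<∣q∣ grows))
  ...   | no stays = inj₁ (expand-mono (⊆∧¬⊂⇒⊇ (p⊆p∪q _) stays))

  component : Fin n → Subset n
  component x = ball x n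

  expand-component : ∀ x → expand (component x) ⊆ component x
  expand-component x with ball-fixed-or-grows x n
  ... | inj₁ fixed = fixed
  ... | inj₂ large = ⊥-elim (n≮n n (≤-trans large (∣p∣≤n (ball x n))))

  x∈ball : ∀ x k → x ∈ ball x k
  x∈ball x zero = x∈⁅x⁆ x
  x∈ball x (suc k) = p⊆p∪q _ (x∈ball x k)

  x∈component : ∀ x → x ∈ component x
  x∈component x = x∈ball x n

  ball⊆component : ∀ x k → ball x k ⊆ component x
  ball⊆component x zero y∈ = subst (_∈ component x) (≡-sym (x∈⁅y⁆⇒x≡y x y∈)) (x∈component x)
  ball⊆component x (suc k) y∈ = expand-component x (expand-mono (ball⊆component x k) y∈)

  ball-reaches : ∀ x k {y} → y ∈ ball x k → ReachIn G (component x) y x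
  ball-reaches x zero y∈ rewrite x∈⁅y⁆⇒x≡y x y∈ = here (x∈component x)
  ball-reaches x (suc k) {y} y∈ with x∈p∪q⁻ (ball x k) (neighbours (ball x k)) y∈
  ... | inj₁ y∈ball = ball-reaches x k y∈ball
  ... | inj₂ y∈N with ∈neighbours⁻ y∈N
  ... | z , z∈ball , e = step (ball⊆component x (suc k) y∈) (Adj-sym e) (ball-reaches x k z∈ball)

  component-isComponent : ∀ x → IsComponent G (component x)
  component-isComponent x = record
    { nonempty = x , x∈component x
    ; connected = λ u v u∈ v∈ → reach-trans (ball-reaches x n u∈) (reach-sym (ball-reaches x n v∈))
    ; closed = λ u v u∈ e → expand-component x (x∈p∪q⁺ (inj₂ (∈neighbours⁺ u∈ e)))
    }

module _ {n : ℕ} (G : Graph n) (u v : Fin n) where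

  private
    IsEdge : Fin n → Fin n → Set
    IsEdge a b = (a ≡ u × b ≡ v) ⊎ (a ≡ v × b ≡ u)

    isEdge? : ∀ a b → Dec (IsEdge a b)
    isEdge? a b = (a ≟ u ×-dec b ≟ v) ⊎-dec (a ≟ v ×-dec b ≟ u)

    IsEdge-sym : ∀ a b → IsEdge a b ⇔ IsEdge b a
    IsEdge-sym a b = mk⇔ flip flip
      where
      flip : ∀ {a b} → IsEdge a b → IsEdge b a
      flip (inj₁ (a≡u , b≡v)) = inj₂ (b≡v , a≡u)
      flip (inj₂ (a≡v , b≡u)) = inj₁ (b≡u , a≡v)

  deleteEdge : Graph n
  deleteEdge = record
    { adj = λ a b → adj G a b ∧ not (does (isEdge? a b))
    ; sym = λ a b → subst (λ d → adj G a b ∧ not (does (isEdge? a b)) ≡ adj G b a ∧ not d)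
                          (does-⇔ (IsEdge-sym a b) (isEdge? a b) (isEdge? b a))
                          (cong (_∧ _) (sym G a b))
    ; irrefl = λ a → cong (_∧ _) (irrefl G a)
    }

  deleteEdge-⊆ : ∀ {a b} → Adj deleteEdge a b → Adj G a b
  deleteEdge-⊆ {a} {b} = ∧-conicalˡ (adj G a b) _

  deleteEdge-removes : adj deleteEdge u v ≡ false
  deleteEdge-removes = trans (cong (λ d → adj G u v ∧ not d) (dec-true (isEdge? u v) (inj₁ (refl , refl))))
                             (∧-zeroʳ (adj G u v))

  private
    deleteEdge-keeps : ∀ {a b} → ¬ IsEdge a b → Adj G a b → Adj deleteEdge a b
    deleteEdge-keeps {a} {b} a≁b e rewrite dec-false (isEdge? a b) a≁b | e = refl

  deleteEdge-keepsˡ : ∀ {a b} → a ≢ u → a ≢ v → Adj G a b → Adj deleteEdge a b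
  deleteEdge-keepsˡ a≢u a≢v = deleteEdge-keeps λ { (inj₁ (a≡u , _)) → a≢u a≡u ; (inj₂ (a≡v , _)) → a≢v a≡v }

  deleteEdge-keepsʳ : ∀ {a b} → b ≢ u → b ≢ v → Adj G a b → Adj deleteEdge a b
  deleteEdge-keepsʳ b≢u b≢v = deleteEdge-keeps λ { (inj₁ (_ , b≡v)) → b≢v b≡v ; (inj₂ (_ , b≡u)) → b≢u b≡u }

  deleteEdge-proper : ∀ {S} → u ∈ S → v ∈ S → Adj G u v → ProperSpanningSubgraphOn G deleteEdge S
  deleteEdge-proper u∈ v∈ e = record
    { sub = λ _ _ _ _ → deleteEdge-⊆
    ; missing = u , v , u∈ , v∈ , e , deleteEdge-removes
    }

module _ {n : ℕ} {G : Graph n} where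

  DD2Pair-restrict : ∀ {S D D₂} → Closed G S → DD2Pair G D D₂ → DD2PairOn G S (D ∩ S) (D₂ ∩ S)
  DD2Pair-restrict {S} {D} {D₂} closed pair = record
    { D⊆S = λ x∈ → proj₂ (x∈p∩q⁻ _ _ x∈)
    ; D₂⊆S = λ x∈ → proj₂ (x∈p∩q⁻ _ _ x∈)
    ; disjoint = λ x x∈D x∈D₂ → disjoint x (proj₁ (x∈p∩q⁻ _ _ x∈D)) (proj₁ (x∈p∩q⁻ _ _ x∈D₂))
    ; dom = dom′
    ; dom₂ = dom₂′
    }
    where
    open DD2PairOn pair
    inside : ∀ {x w} → x ∈ S → Adj G w x → w ∈ S
    inside x∈S e = closed _ _ x∈S (Adj-sym G e)
    dom′ : Dominating G S (D ∩ S)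
    dom′ x x∈S x∉ with dom x ∈⊤ (λ x∈D → x∉ (x∈p∩q⁺ (x∈D , x∈S)))
    ... | w , w∈D , e = w , x∈p∩q⁺ (w∈D , inside x∈S e) , e
    dom₂′ : TwoDominating G S (D₂ ∩ S)
    dom₂′ x x∈S x∉ with dom₂ x ∈⊤ (λ x∈D₂ → x∉ (x∈p∩q⁺ (x∈D₂ , x∈S)))
    ... | w₁ , w₂ , w₁≢w₂ , w₁∈ , w₂∈ , e₁ , e₂ =
      w₁ , w₂ , w₁≢w₂ , x∈p∩q⁺ (w₁∈ , inside x∈S e₁) , x∈p∩q⁺ (w₂∈ , inside x∈S e₂) , e₁ , e₂

  -- The edge uv is only needed to dominate v, and no vertex of D₂ is an end of it.
  DD2PairOn-deleteEdge : ∀ {S D D₂ u v} → DD2PairOn G S D D₂ → u ∈ D → v ∈ S → v ∉ D → v ∉ D₂ →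
                         DD2PairOn (deleteEdge G u v) S (D ∪ ⁅ v ⁆) D₂
  DD2PairOn-deleteEdge {S} {D} {D₂} {u} {v} pair u∈D v∈S v∉D v∉D₂ = record
    { D⊆S = λ x∈ → [ D⊆S , (λ x∈v → subst (_∈ S) (≡-sym (x∈⁅y⁆⇒x≡y v x∈v)) v∈S) ] (x∈p∪q⁻ D ⁅ v ⁆ x∈)
    ; D₂⊆S = D₂⊆S
    ; disjoint = disjoint′
    ; dom = dom′
    ; dom₂ = dom₂′
    }
    where
    open DD2PairOn pair
    disjoint′ : ∀ x → x ∈ D ∪ ⁅ v ⁆ → x ∉ D₂
    disjoint′ x x∈ with x∈p∪q⁻ D ⁅ v ⁆ x∈
    ... | inj₁ x∈D = disjoint x x∈D
    ... | inj₂ x∈v rewrite x∈⁅y⁆⇒x≡y v x∈v = v∉D₂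
    dom′ : Dominating (deleteEdge G u v) S (D ∪ ⁅ v ⁆)
    dom′ x x∈S x∉ with dom x x∈S (x∉ ∘ p⊆p∪q _)
    ... | w , w∈D , e = w , p⊆p∪q _ w∈D , deleteEdge-keepsʳ G u v x≢u x≢v e
      where
      x≢u : x ≢ u
      x≢u refl = x∉ (p⊆p∪q _ u∈D)
      x≢v : x ≢ v
      x≢v refl = x∉ (q⊆p∪q D _ (x∈⁅x⁆ v))
    dom₂′ : TwoDominating (deleteEdge G u v) S D₂
    dom₂′ x x∈S x∉ with dom₂ x x∈S x∉
    ... | w₁ , w₂ , w₁≢w₂ , w₁∈ , w₂∈ , e₁ , e₂ = w₁ , w₂ , w₁≢w₂ , w₁∈ , w₂∈ , keep w₁∈ e₁ , keep w₂∈ e₂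
      where
      keep : ∀ {w} → w ∈ D₂ → Adj G w x → Adj (deleteEdge G u v) w x
      keep w∈ = deleteEdge-keepsˡ G u v (λ { refl → disjoint u u∈D w∈ }) (λ { refl → v∉D₂ w∈ })

  DD2Pair-∁ : ∀ {D D₂} → DD2Pair G D D₂ → DD2Pair G (∁ D₂) D₂
  DD2Pair-∁ {D₂ = D₂} pair = record
    { D⊆S = λ _ → ∈⊤
    ; D₂⊆S = λ _ → ∈⊤
    ; disjoint = λ x → x∈∁p⇒x∉p
    ; dom = dom′
    ; dom₂ = dom₂
    }
    where
    open DD2PairOn pair
    dom′ : Dominating G (Full n) (∁ D₂)
    dom′ x _ x∉ with dom x ∈⊤ (λ x∈D → disjoint x x∈D (x∉∁p⇒x∈p x∉))
    ... | w , w∈D , e = w , x∉p⇒x∈∁p (disjoint w w∈D) , e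

  minimal⇒∁⊆ : MinimalDD2Graph G → ∀ {D D₂} → DD2Pair G D D₂ → ∁ D ⊆ D₂
  minimal⇒∁⊆ minimal {D} {D₂} pair {v} v∈∁D with v ∈? D₂ | DD2PairOn.dom pair v ∈⊤ (x∈∁p⇒x∉p v∈∁D)
  ... | yes v∈D₂ | _ = v∈D₂
  ... | no v∉D₂ | u , u∈D , e = ⊥-elim (proj₂ (minimal S (component-isComponent G v)) (deleteEdge G u v)
                                   (deleteEdge-proper G u v u∈S v∈S e)
                                   (D ∩ S ∪ ⁅ v ⁆ , D₂ ∩ S , pairOn))
    where
    S = component G v
    closed = IsComponent.closed (component-isComponent G v)
    v∈S = x∈component G v
    u∈S = closed v u v∈S (Adj-sym G e)
    pairOn : DD2PairOn (deleteEdge G u v) S (D ∩ S ∪ ⁅ v ⁆) (D₂ ∩ S)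
    pairOn = DD2PairOn-deleteEdge (DD2Pair-restrict closed pair) (x∈p∩q⁺ (u∈D , u∈S)) v∈S
               (x∈∁p⇒x∉p v∈∁D ∘ proj₁ ∘ x∈p∩q⁻ _ _) (v∉D₂ ∘ proj₁ ∘ x∈p∩q⁻ _ _)

  DD2Pair-glue : (C : Fin n → Subset n) (P : Fin n → Subset n × Subset n) →
                 (∀ x → x ∈ C x) → (∀ {x y} → y ∈ C x → P y ≡ P x) →
                 (∀ x → uncurry (DD2PairOn G (C x)) (P x)) →
                 DD2Pair G (diagonal (proj₁ ∘ P)) (diagonal (proj₂ ∘ P))
  DD2Pair-glue C P x∈C agree local = record
    { D⊆S = λ _ → ∈⊤
    ; D₂⊆S = λ _ → ∈⊤
    ; disjoint = λ x x∈D x∈D₂ → DD2PairOn.disjoint (local x) x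
                                    (∈diagonal⁻ (proj₁ ∘ P) x∈D) (∈diagonal⁻ (proj₂ ∘ P) x∈D₂)
    ; dom = dom′
    ; dom₂ = dom₂′
    }
    where
    pull : ∀ (f : Subset n × Subset n → Subset n) {x w} → w ∈ C x → w ∈ f (P x) → w ∈ diagonal (f ∘ P)
    pull f w∈C w∈ = ∈diagonal⁺ (f ∘ P) (subst (λ p → _ ∈ f p) (≡-sym (agree w∈C)) w∈)
    dom′ : Dominating G (Full n) (diagonal (proj₁ ∘ P))
    dom′ x _ x∉ with DD2PairOn.dom (local x) x (x∈C x) (x∉ ∘ ∈diagonal⁺ (proj₁ ∘ P))
    ... | w , w∈ , e = w , pull proj₁ (DD2PairOn.D⊆S (local x) w∈) w∈ , e
    dom₂′ : TwoDominating G (Full n) (diagonal (proj₂ ∘ P))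
    dom₂′ x _ x∉ with DD2PairOn.dom₂ (local x) x (x∈C x) (x∉ ∘ ∈diagonal⁺ (proj₂ ∘ P))
    ... | w₁ , w₂ , w₁≢w₂ , w₁∈ , w₂∈ , e₁ , e₂ =
      w₁ , w₂ , w₁≢w₂ , pull proj₂ (DD2PairOn.D₂⊆S (local x) w₁∈) w₁∈
                      , pull proj₂ (DD2PairOn.D₂⊆S (local x) w₂∈) w₂∈ , e₁ , e₂

  module _ (componentwise : ∀ S → IsComponent G S → IsDD2GraphOn G S) where

    -- The pair depends on the vertex set alone (through its canonical member),
    -- not on the proof that it is a component, so components agree on it.
    componentPair : Subset n → Subset n × Subset n
    componentPair S with nonempty? S
    ... | yes (r , _) = proj₁ pair , proj₁ (proj₂ pair)
      where pair = componentwise (component G r) (component-isComponent G r)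
    ... | no _ = ⊥ , ⊥

    componentPair-valid : ∀ {S} → IsComponent G S → uncurry (DD2PairOn G S) (componentPair S)
    componentPair-valid {S} cS with nonempty? S
    ... | yes (r , r∈S) = subst (λ T → DD2PairOn G T _ _)
                            (component-unique G (component-isComponent G r) cS (x∈component G r) r∈S)
                            (proj₂ (proj₂ (componentwise (component G r) (component-isComponent G r))))
    ... | no empty = contradiction (IsComponent.nonempty cS) empty

    componentwise⇒DD2Pair : ∃[ D ] ∃[ D₂ ] DD2Pair G D D₂
    componentwise⇒DD2Pair = _ , _ , DD2Pair-glue (component G) (componentPair ∘ component G) (x∈component G)
      (λ {x} {y} y∈ → cong componentPair
        (component-unique G (component-isComponent G y) (component-isComponent G x) (x∈component G y) y∈))
      (componentPair-valid ∘ component-isComponent G)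

mainTheorem5 : ∀ (n : ℕ) (G : Graph n) → MinimalDD2Graph G → GammaGamma2 G n
mainTheorem5 n G minimal = (∁ D₂ , D₂ , DD2Pair-∁ pair , ∣∁p∣+∣p∣≡n D₂)
                         , λ D D₂ pair → ∁⊆⇒n≤∣p∣+∣q∣ (minimal⇒∁⊆ minimal pair)
  where
  glued = componentwise⇒DD2Pair (λ S cS → proj₁ (minimal S cS))
  D₂ = proj₁ (proj₂ glued)
  pair = proj₂ (proj₂ glued)
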